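{- For every Edge Firing Game $E$ on a finite graph, there exists a simple Edge Firing Game whose configuration space is isomorphic (as an ordered set) to the configuration space of $E$.
   Context: An Edge Firing Game (EFG) is given by a connected undirected graph $G=(V,E)$, a distinguished vertex $s\in V$ called the sink, and an orientation $G_0$ of $G$ (an orientation assigns to each edge $\{v,v'\}\in E$ exactly one of the directions $(v,v')$ or $(v',v)$). Configurations are orientations of $G$; $G_0$ is the initial configuration. Firing rule: if in configuration $C$ some vertex $\nu\neq s$ has only incoming edges (no outgoing edges), one may fire $\nu$, i.e. reverse all edges incident to $\nu$, obtaining a new configuration. The configuration space is the set of configurations reachable from $G_0$ by sequences of firings, ordered by $C\ge C'$ iff some (possibly empty) sequence of firings transforms $C$ into $C'$. The EFG is called simple if, in any sequence of firings starting from the initial configuration, each vertex is fired at most once. -}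

module Defs where

open import Data.Nat using (ℕ)
open import Data.Fin using (Fin; _≟_)
open import Data.Bool using (Bool; true; false; not; if_then_else_)
open import Data.Vec using (Vec; lookup; tabulate)
open import Data.List using (List; []; _∷_)
open import Data.List.Relation.Unary.Unique.Propositional using (Unique)
open import Data.Product using (Σ; ∃; _×_; _,_; proj₁; proj₂)
open import Data.Sum using (_⊎_)
open import Relation.Binary.PropositionalEquality using (_≡_; _≢_)
open import Relation.Binary.Construct.Closure.ReflexiveTransitive using (Star)
open import Relation.Nullary.Decidable using (⌊_⌋; _⊎-dec_)

SameEnds : ∀ {n} → Fin n × Fin n → Fin n × Fin n → Set
SameEnds (a , b) (c , d) = (a ≡ c × b ≡ d) ⊎ (a ≡ d × b ≡ c)

-- A finite, simple (loopless, no parallel edges), connected undirected graph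
-- with vertex set Fin n and edge set Fin m; edge e has endpoints ends e
-- (the order in the pair is only a bookkeeping reference direction).
record Graph : Set where
  field
    n : ℕ
    m : ℕ
    ends : Fin m → Fin n × Fin n
    loopless : ∀ e → proj₁ (ends e) ≢ proj₂ (ends e)
    noMulti : ∀ e e′ → SameEnds (ends e) (ends e′) → e ≡ e′

  Adj : Fin n → Fin n → Set
  Adj u v = ∃ λ e → SameEnds (ends e) (u , v)

  field
    connected : ∀ u v → Star Adj u v

  -- An orientation: for each edge, true = directed proj₁ → proj₂,
  -- false = directed proj₂ → proj₁.
  Orientation : Set
  Orientation = Vec Bool m

  tailOf : Orientation → Fin m → Fin n
  tailOf o e = if lookup o e then proj₁ (ends e) else proj₂ (ends e)

  incident? : Fin n → Fin m → Bool
  incident? v e = ⌊ (proj₁ (ends e) ≟ v) ⊎-dec (proj₂ (ends e) ≟ v) ⌋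

  fire : Fin n → Orientation → Orientation
  fire v o = tabulate λ e → if incident? v e then not (lookup o e) else lookup o e

record EFG : Set where
  field
    graph : Graph
  open Graph graph public
  field
    sink : Fin n
    initial : Orientation

  CanFire : Orientation → Fin n → Set
  CanFire C v = (v ≢ sink) × (∀ e → tailOf C e ≢ v)

  data Run : Orientation → List (Fin n) → Orientation → Set where
    done : ∀ {C} → Run C [] C
    step : ∀ {C v vs D} → CanFire C v → Run (fire v C) vs D → Run C (v ∷ vs) D

  _≽_ : Orientation → Orientation → Set
  C ≽ D = ∃ λ vs → Run C vs D

  Config : Set
  Config = Σ Orientation λ C → initial ≽ C

  _≥ᶜ_ : Config → Config → Set
  x ≥ᶜ y = proj₁ x ≽ proj₁ y

IsSimple : EFG → Set
IsSimple E = ∀ vs D → Run initial vs D → Unique vs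
  where open EFG E

-- Order isomorphism of configuration spaces (elements are identified by their
-- underlying orientation, the reachability witness being irrelevant).
record ConfigIso (E E′ : EFG) : Set where
  private
    module A = EFG E
    module B = EFG E′
  field
    to : A.Config → B.Config
    from : B.Config → A.Config
    from∘to : ∀ x → proj₁ (from (to x)) ≡ proj₁ x
    to∘from : ∀ y → proj₁ (to (from y)) ≡ proj₁ y
    to-mono : ∀ x y → x A.≥ᶜ y → to x B.≥ᶜ to y
    to-reflect : ∀ x y → to x B.≥ᶜ to y → x A.≥ᶜ y

-- A configuration reachable in E is determined by how often each vertex has fired: an edge is
-- reversed iff the firing counts of its ends have odd sum. Along every edge these counts differ by at
-- most one and the sink never fires, so they are bounded by the distance to the sink and, by
-- connectivity, recovered from the configuration. The simple game has a vertex (v , j) for each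
-- vertex v and each j up to that bound, wired so that (v , j) can fire exactly when v can fire for
-- the (j+1)-st time in E; an edge from the sink makes it fire at most once. Firing v in E then
-- matches firing (v , f v) in the simple game, and both configuration spaces are in order-preserving
-- bijection with the same firing counts.
module Submission where

open import Defs
open import Data.Bool using (Bool; true; false; not; _∧_; _xor_; if_then_else_)
open import Data.Bool.Properties
  using (∧-identityʳ; not-distribˡ-xor; not-distribʳ-xor; xor-same; xor-identityʳ; not-injective)
open import Data.Empty using (⊥; ⊥-elim)
open import Data.Fin using (Fin; zero; suc; _≟_; toℕ; fromℕ<; inject₁; combine; remQuot)
import Data.Fin.Properties as Fin
open import Data.Fin.Properties
  using (+↔⊎; *↔×; combine-injective; combine-remQuot; remQuot-combine; toℕ-inject₁; toℕ-injective; toℕ-fromℕ<)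
open import Data.List using (List; []; _∷_; foldl; map; allFin)
open import Data.List.Extrema.Nat using (max; xs≤max)
open import Data.List.Membership.Propositional.Properties using (∈-map⁺; ∈-allFin)
open import Data.List.Relation.Unary.All as All using (All; []; _∷_)
open import Data.List.Relation.Unary.AllPairs using ([]; _∷_)
open import Data.List.Relation.Unary.Unique.Propositional using (Unique)
open import Data.Nat using (ℕ; zero; suc; _+_; _*_; _≤_; _<_; _<ᵇ_; z≤n; s≤s; s≤s⁻¹)
open import Data.Nat.Properties
  using (1+n≢n; suc-injective; <ᵇ-reflects-<; <⇒≱; ≮⇒≥; ≤-refl; ≤-reflexive; ≤-trans; ≤-antisym; <-irrefl;
         n≤1+n; m≤n⇒m≤1+n)
open import Data.Product using (∃; _×_; _,_; proj₁; proj₂; uncurry)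
open import Data.Sum using (_⊎_; inj₁; inj₂; [_,_])
open import Data.Sum.Function.Propositional using (_⊎-↔_)
open import Data.Vec using (lookup; tabulate)
open import Data.Vec.Properties using (lookup∘tabulate; tabulate∘lookup; tabulate-cong)
open import Function using (_∘_; id)
open import Function.Bundles using (Inverse; _↔_)
open import Function.Properties.Inverse using (↔-trans)
open import Relation.Binary.Construct.Closure.ReflexiveTransitive using (Star; ε; _◅_; _◅◅_; reverse)
open import Relation.Binary.PropositionalEquality
  using (_≡_; _≢_; refl; sym; trans; cong; cong₂; subst; subst₂; _≗_; module ≡-Reasoning)
open import Relation.Nullary using (Dec; ¬_; yes; no; ofʸ; ofⁿ)
open import Relation.Nullary.Decidable using (⌊_⌋; _⊎-dec_; isYes≗does; dec-true; dec-false)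

⌊⌋-yes : ∀ {A : Set} (a? : Dec A) → A → ⌊ a? ⌋ ≡ true
⌊⌋-yes a? a = trans (isYes≗does a?) (dec-true a? a)

⌊⌋-no : ∀ {A : Set} (a? : Dec A) → ¬ A → ⌊ a? ⌋ ≡ false
⌊⌋-no a? ¬a = trans (isYes≗does a?) (dec-false a? ¬a)

odd : ℕ → Bool
odd zero = false
odd (suc n) = not (odd n)

odd-xor-suc : ∀ k → odd k xor odd (suc k) ≡ true
odd-xor-suc k = trans (sym (not-distribʳ-xor (odd k) (odd k))) (cong not (xor-same (odd k)))

false≢true : false ≢ true
false≢true ()

xor-closed : ∀ {a b} → (a ≡ true → b ≡ true) → a xor b ≡ b ∧ not a
xor-closed {true} a⇒b rewrite a⇒b refl = refl
xor-closed {false} {b} _ = sym (∧-identityʳ b)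

if-split : ∀ {A : Set} b {x y z : A} → (if b then x else y) ≡ z → b ≡ true × x ≡ z ⊎ b ≡ false × y ≡ z
if-split true eq = inj₁ (refl , eq)
if-split false eq = inj₂ (refl , eq)

∧-not-true : ∀ a b → a ∧ not b ≡ true → a ≡ true × b ≡ false
∧-not-true true false _ = refl , refl

<ᵇ-true : ∀ {m n} → m < n → (m <ᵇ n) ≡ true
<ᵇ-true {m} {n} m<n with m <ᵇ n | <ᵇ-reflects-< m n
... | true | _ = refl
... | false | ofⁿ m≮n = ⊥-elim (m≮n m<n)

<ᵇ-false : ∀ {m n} → n ≤ m → (m <ᵇ n) ≡ false
<ᵇ-false {m} {n} n≤m with m <ᵇ n | <ᵇ-reflects-< m n
... | true | ofʸ m<n = ⊥-elim (<⇒≱ m<n n≤m)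
... | false | _ = refl

<ᵇ-true⁻¹ : ∀ {m n} → (m <ᵇ n) ≡ true → m < n
<ᵇ-true⁻¹ {m} {n} eq with m <ᵇ n | <ᵇ-reflects-< m n
<ᵇ-true⁻¹ refl | true | ofʸ m<n = m<n

<ᵇ-false⁻¹ : ∀ {m n} → (m <ᵇ n) ≡ false → n ≤ m
<ᵇ-false⁻¹ {m} {n} eq with m <ᵇ n | <ᵇ-reflects-< m n
<ᵇ-false⁻¹ refl | false | ofⁿ m≮n = ≮⇒≥ m≮n

<ᵇ-suc : ∀ {m n} → m ≢ n → (m <ᵇ suc n) ≡ (m <ᵇ n)
<ᵇ-suc {zero} {zero} m≢n = ⊥-elim (m≢n refl)
<ᵇ-suc {zero} {suc n} _ = refl
<ᵇ-suc {suc m} {zero} _ = refl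
<ᵇ-suc {suc m} {suc n} m≢n = <ᵇ-suc (m≢n ∘ cong suc)

<ᵇ-agree⇒≤ : ∀ {a b d} → b ≤ d → (∀ (i : Fin (suc d)) → (toℕ i <ᵇ a) ≡ (toℕ i <ᵇ b)) → a ≤ b
<ᵇ-agree⇒≤ {a} {b} b≤d agree = ≮⇒≥ λ b<a → false≢true (begin
  false         ≡⟨ <ᵇ-false {b} ≤-refl ⟨
  b <ᵇ b        ≡⟨ cong (_<ᵇ b) toℕ-i ⟨
  toℕ i <ᵇ b    ≡⟨ agree i ⟨
  toℕ i <ᵇ a    ≡⟨ cong (_<ᵇ a) toℕ-i ⟩
  b <ᵇ a        ≡⟨ <ᵇ-true b<a ⟩
  true          ∎)
  where
  open ≡-Reasoning
  i : Fin _
  i = fromℕ< (s≤s b≤d)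
  toℕ-i : toℕ i ≡ b
  toℕ-i = toℕ-fromℕ< (s≤s b≤d)

sameEnds-sym : ∀ {k} {p q : Fin k × Fin k} → SameEnds p q → SameEnds q p
sameEnds-sym (inj₁ (refl , refl)) = inj₁ (refl , refl)
sameEnds-sym (inj₂ (refl , refl)) = inj₂ (refl , refl)

sameEnds-swap : ∀ {k} {p : Fin k × Fin k} {a b} → SameEnds p (a , b) → SameEnds p (b , a)
sameEnds-swap (inj₁ (p , q)) = inj₂ (p , q)
sameEnds-swap (inj₂ (p , q)) = inj₁ (p , q)

sameEnds-trans : ∀ {k} {p q r : Fin k × Fin k} → SameEnds p q → SameEnds q r → SameEnds p r
sameEnds-trans (inj₁ (refl , refl)) s = s
sameEnds-trans (inj₂ (refl , refl)) (inj₁ (refl , refl)) = inj₂ (refl , refl)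
sameEnds-trans (inj₂ (refl , refl)) (inj₂ (refl , refl)) = inj₁ (refl , refl)

sameEnds-endpoint : ∀ {k} {p q : Fin k × Fin k} {v} → SameEnds p q →
                    proj₁ p ≡ v ⊎ proj₂ p ≡ v → proj₁ q ≡ v ⊎ proj₂ q ≡ v
sameEnds-endpoint (inj₁ (refl , refl)) x = x
sameEnds-endpoint (inj₂ (refl , refl)) (inj₁ x) = inj₂ x
sameEnds-endpoint (inj₂ (refl , refl)) (inj₂ x) = inj₁ x

module Firing (E : EFG) where
  open EFG E

  incident?-endpoint : ∀ {v e a b} → SameEnds (ends e) (a , b) → a ≡ v ⊎ b ≡ v → incident? v e ≡ true
  incident?-endpoint {v} {e} s p =
    ⌊⌋-yes ((proj₁ (ends e) ≟ v) ⊎-dec (proj₂ (ends e) ≟ v)) (sameEnds-endpoint (sameEnds-sym s) p)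

  incident?-apart : ∀ {v e a b} → SameEnds (ends e) (a , b) → a ≢ v → b ≢ v → incident? v e ≡ false
  incident?-apart {v} {e} s a≢v b≢v = ⌊⌋-no ((proj₁ (ends e) ≟ v) ⊎-dec (proj₂ (ends e) ≟ v)) λ p →
    [ a≢v , b≢v ] (sameEnds-endpoint s p)

  lookup-fire : ∀ v C e → lookup (fire v C) e ≡ (if incident? v e then not (lookup C e) else lookup C e)
  lookup-fire v C e = lookup∘tabulate _ e

  tailOf-endpoint : ∀ {C e a b} → SameEnds (ends e) (a , b) → tailOf C e ≡ a ⊎ tailOf C e ≡ b
  tailOf-endpoint {C} {e} s with lookup C e | s
  ... | true | inj₁ (p , _) = inj₁ p
  ... | true | inj₂ (p , _) = inj₂ p
  ... | false | inj₁ (_ , q) = inj₂ q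
  ... | false | inj₂ (_ , q) = inj₁ q

  tailOf-fire-endpoint : ∀ {C e a b} → SameEnds (ends e) (a , b) → tailOf C e ≡ b → tailOf (fire a C) e ≡ a
  tailOf-fire-endpoint {C} {e} {a} s t
    rewrite lookup-fire a C e | incident?-endpoint {a} {e} s (inj₁ refl) with lookup C e | s
  ... | true | inj₁ (p , q) = ⊥-elim (loopless e (trans t (sym q)))
  ... | true | inj₂ (_ , q) = q
  ... | false | inj₁ (p , _) = p
  ... | false | inj₂ (p , _) = ⊥-elim (loopless e (trans p (sym t)))

  tailOf-fire-apart : ∀ {C e a b x} → SameEnds (ends e) (a , b) → a ≢ x → b ≢ x →
                      tailOf (fire x C) e ≡ tailOf C e
  tailOf-fire-apart {C} {e} {x = x} s a≢x b≢x
    rewrite lookup-fire x C e | incident?-apart {x} {e} s a≢x b≢x = refl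

  -- Once v has fired, its edge to the sink points to the sink; the sink never fires, so v never again
  -- has only incoming edges.
  sinkAdjacent⇒simple : (∀ v → v ≢ sink → Adj v sink) → IsSimple E
  sinkAdjacent⇒simple adj _ _ = firedOnce
    where
    neverAgain : ∀ {v e C ws D} → SameEnds (ends e) (v , sink) → tailOf C e ≡ v → Run C ws D → All (v ≢_) ws
    neverAgain s t done = []
    neverAgain {v} {e} {C} s t (step {v = w} (w≢sink , noOut) r) =
      v≢w ∷ neverAgain s (trans (tailOf-fire-apart {C} s v≢w (w≢sink ∘ sym)) t) r
      where
      v≢w : v ≢ w
      v≢w refl = noOut e t
    firedOnce : ∀ {C vs D} → Run C vs D → Unique vs
    firedOnce done = []
    firedOnce {C} (step {v = v} (v≢sink , noOut) r) with adj v v≢sink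
    ... | e , s with tailOf-endpoint {C} s
    ...   | inj₁ t = ⊥-elim (noOut e t)
    ...   | inj₂ t = neverAgain s (tailOf-fire-endpoint {C} s t) r ∷ firedOnce r

module Counting (E : EFG) where
  open EFG E
  open Firing E

  tail₀ head₀ : Fin m → Fin n
  tail₀ = tailOf initial
  head₀ e = if lookup initial e then proj₂ (ends e) else proj₁ (ends e)

  ends-tail₀-head₀ : ∀ e → SameEnds (ends e) (tail₀ e , head₀ e)
  ends-tail₀-head₀ e with lookup initial e
  ... | true = inj₁ (refl , refl)
  ... | false = inj₂ (refl , refl)

  tail₀≢head₀ : ∀ e → tail₀ e ≢ head₀ e
  tail₀≢head₀ e with lookup initial e
  ... | true = loopless e
  ... | false = loopless e ∘ sym

  incident?-tail₀-head₀ : ∀ {v e} → tail₀ e ≡ v ⊎ head₀ e ≡ v → incident? v e ≡ true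
  incident?-tail₀-head₀ {e = e} = incident?-endpoint (ends-tail₀-head₀ e)

  Counts : Set
  Counts = Fin n → ℕ

  zeros : Counts
  zeros _ = 0

  _⊕_ : Counts → Fin n → Counts
  (c ⊕ v) u = if ⌊ u ≟ v ⌋ then suc (c u) else c u

  _⊕*_ : Counts → List (Fin n) → Counts
  _⊕*_ = foldl _⊕_

  ⊕-same : ∀ c {u v} → u ≡ v → (c ⊕ v) u ≡ suc (c u)
  ⊕-same c {u} {v} u≡v rewrite ⌊⌋-yes (u ≟ v) u≡v = refl

  ⊕-other : ∀ c {u v} → u ≢ v → (c ⊕ v) u ≡ c u
  ⊕-other c {u} {v} u≢v rewrite ⌊⌋-no (u ≟ v) u≢v = refl

  flips : Counts → Fin m → Bool
  flips c e = odd (c (tail₀ e)) xor odd (c (head₀ e))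

  orient : Counts → Orientation
  orient c = tabulate λ e → lookup initial e xor flips c e

  lookup-orient : ∀ c e → lookup (orient c) e ≡ lookup initial e xor flips c e
  lookup-orient c e = lookup∘tabulate _ e

  flips-⊕ : ∀ c v e → flips (c ⊕ v) e ≡ (if incident? v e then not (flips c e) else flips c e)
  flips-⊕ c v e with tail₀ e ≟ v | head₀ e ≟ v
  ... | yes t≡v | yes h≡v = ⊥-elim (tail₀≢head₀ e (trans t≡v (sym h≡v)))
  ... | yes t≡v | no _ rewrite incident?-tail₀-head₀ (inj₁ t≡v) =
    sym (not-distribˡ-xor (odd (c (tail₀ e))) (odd (c (head₀ e))))
  ... | no _ | yes h≡v rewrite incident?-tail₀-head₀ (inj₂ h≡v) =
    sym (not-distribʳ-xor (odd (c (tail₀ e))) (odd (c (head₀ e))))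
  ... | no t≢v | no h≢v rewrite incident?-apart (ends-tail₀-head₀ e) t≢v h≢v = refl

  fire-orient : ∀ c v → fire v (orient c) ≡ orient (c ⊕ v)
  fire-orient c v = tabulate-cong pointwise
    where
    open ≡-Reasoning
    flip-xor : ∀ b i {x} → (if b then not (i xor x) else i xor x) ≡ i xor (if b then not x else x)
    flip-xor true i = not-distribʳ-xor i _
    flip-xor false i = refl
    pointwise : ∀ e → (if incident? v e then not (lookup (orient c) e) else lookup (orient c) e)
                      ≡ lookup initial e xor flips (c ⊕ v) e
    pointwise e = begin
      (if incident? v e then not (lookup (orient c) e) else lookup (orient c) e)
        ≡⟨ cong (λ b → if incident? v e then not b else b) (lookup-orient c e) ⟩
      (if incident? v e then not (lookup initial e xor flips c e) else lookup initial e xor flips c e)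
        ≡⟨ flip-xor (incident? v e) (lookup initial e) ⟩
      lookup initial e xor (if incident? v e then not (flips c e) else flips c e)
        ≡⟨ cong (lookup initial e xor_) (sym (flips-⊕ c v e)) ⟩
      lookup initial e xor flips (c ⊕ v) e ∎

  orient-cong : ∀ {c c′} → c ≗ c′ → orient c ≡ orient c′
  orient-cong c≗c′ = tabulate-cong λ e →
    cong₂ (λ a b → lookup initial e xor (odd a xor odd b)) (c≗c′ (tail₀ e)) (c≗c′ (head₀ e))

  orient-zeros : orient zeros ≡ initial
  orient-zeros = trans (tabulate-cong λ e → xor-identityʳ (lookup initial e)) (tabulate∘lookup initial)

  run-orient : ∀ c {vs D} → Run (orient c) vs D → D ≡ orient (c ⊕* vs)
  run-orient c done = refl
  run-orient c {v ∷ _} (step _ r) = run-orient (c ⊕ v) (subst (λ C → Run C _ _) (fire-orient c v) r)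

  tailOf-orient : ∀ c e → tailOf (orient c) e ≡ (if flips c e then head₀ e else tail₀ e)
  tailOf-orient c e rewrite lookup-orient c e with lookup initial e | flips c e
  ... | true | true = refl
  ... | true | false = refl
  ... | false | true = refl
  ... | false | false = refl

  orient-flips : ∀ {c c′} → orient c ≡ orient c′ → flips c ≗ flips c′
  orient-flips {c} {c′} eq e = xor-cancelˡ (lookup initial e)
    (trans (sym (lookup-orient c e)) (trans (cong (λ o → lookup o e) eq) (lookup-orient c′ e)))
    where
    xor-cancelˡ : ∀ i {x y} → i xor x ≡ i xor y → x ≡ y
    xor-cancelˡ true = not-injective
    xor-cancelˡ false = id

  edge-injective : ∀ {e e′} → SameEnds (tail₀ e , head₀ e) (tail₀ e′ , head₀ e′) → e ≡ e′
  edge-injective {e} {e′} s = noMulti e e′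
    (sameEnds-trans (ends-tail₀-head₀ e) (sameEnds-trans s (sameEnds-sym (ends-tail₀-head₀ e′))))

  Adj⇒edge : ∀ {u w} → Adj u w → ∃ λ e → SameEnds (tail₀ e , head₀ e) (u , w)
  Adj⇒edge (e , s) = e , sameEnds-trans (sameEnds-sym (ends-tail₀-head₀ e)) s

module Admissibility (E : EFG) where
  open EFG E
  open Counting E

  data Step (f : Counts) (e : Fin m) : Set where
    level : f (head₀ e) ≡ f (tail₀ e) → Step f e
    ahead : f (head₀ e) ≡ suc (f (tail₀ e)) → Step f e

  Admissible : Counts → Set
  Admissible f = f sink ≡ 0 × (∀ e → Step f e)

  Ready : Counts → Fin n → Set
  Ready f v = v ≢ sink × (∀ e → tail₀ e ≡ v → f (head₀ e) ≡ suc (f v))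
                       × (∀ e → head₀ e ≡ v → f (tail₀ e) ≡ f v)

  sucIf : Bool → ℕ → ℕ
  sucIf b x = if b then suc x else x

  step-sucIf : ∀ {f e} → Step f e → f (head₀ e) ≡ sucIf (flips f e) (f (tail₀ e))
  step-sucIf {f} {e} (level h≡t) rewrite h≡t | xor-same (odd (f (tail₀ e))) = refl
  step-sucIf {f} {e} (ahead h≡1+t) rewrite h≡1+t | odd-xor-suc (f (tail₀ e)) = refl

  tailOf-step : ∀ {f e} → Step f e → f (head₀ e) ≡ f (tail₀ e) × tailOf (orient f) e ≡ tail₀ e
                                   ⊎ f (head₀ e) ≡ suc (f (tail₀ e)) × tailOf (orient f) e ≡ head₀ e
  tailOf-step {f} {e} s with flips f e in eq | step-sucIf s
  ... | false | h≡t = inj₁ (h≡t , trans (tailOf-orient f e) (cong (if_then head₀ e else tail₀ e) eq))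
  ... | true | h≡1+t = inj₂ (h≡1+t , trans (tailOf-orient f e) (cong (if_then head₀ e else tail₀ e) eq))

  canFire⇒ready : ∀ {f v} → Admissible f → CanFire (orient f) v → Ready f v
  canFire⇒ready {f} {v} (_ , steps) (v≢sink , noOut) = v≢sink , outgoing , incoming
    where
    outgoing : ∀ e → tail₀ e ≡ v → f (head₀ e) ≡ suc (f v)
    outgoing e refl with tailOf-step (steps e)
    ... | inj₁ (_ , t) = ⊥-elim (noOut e t)
    ... | inj₂ (h≡1+t , _) = h≡1+t
    incoming : ∀ e → head₀ e ≡ v → f (tail₀ e) ≡ f v
    incoming e refl with tailOf-step (steps e)
    ... | inj₁ (h≡t , _) = sym h≡t
    ... | inj₂ (_ , t) = ⊥-elim (noOut e t)

  ready⇒canFire : ∀ {f v} → Admissible f → Ready f v → CanFire (orient f) v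
  ready⇒canFire {f} {v} (_ , steps) (v≢sink , outgoing , incoming) = v≢sink , noOut
    where
    noOut : ∀ e → tailOf (orient f) e ≢ v
    noOut e t≡v with tailOf-step (steps e)
    ... | inj₁ (h≡t , t) = 1+n≢n (begin
      suc (f v)          ≡⟨ outgoing e t₀≡v ⟨
      f (head₀ e)        ≡⟨ h≡t ⟩
      f (tail₀ e)        ≡⟨ cong f t₀≡v ⟩
      f v                ∎)
      where
      open ≡-Reasoning
      t₀≡v : tail₀ e ≡ v
      t₀≡v = trans (sym t) t≡v
    ... | inj₂ (h≡1+t , t) = 1+n≢n (begin
      suc (f (tail₀ e))  ≡⟨ h≡1+t ⟨
      f (head₀ e)        ≡⟨ cong f h₀≡v ⟩
      f v                ≡⟨ incoming e h₀≡v ⟨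
      f (tail₀ e)        ∎)
      where
      open ≡-Reasoning
      h₀≡v : head₀ e ≡ v
      h₀≡v = trans (sym t) t≡v

  step-resp : ∀ {f f′ e} → f (tail₀ e) ≡ f′ (tail₀ e) → f (head₀ e) ≡ f′ (head₀ e) → Step f e → Step f′ e
  step-resp t h (level h≡t) = level (trans (sym h) (trans h≡t t))
  step-resp t h (ahead h≡1+t) = ahead (trans (sym h) (trans h≡1+t (cong suc t)))

  step-⊕ : ∀ {f v e} → Ready f v → Step f e → Step (f ⊕ v) e
  step-⊕ {f} {v} {e} (_ , outgoing , incoming) s with tail₀ e ≟ v | head₀ e ≟ v
  ... | yes t≡v | yes h≡v = ⊥-elim (tail₀≢head₀ e (trans t≡v (sym h≡v)))
  ... | yes t≡v | no h≢v = level (begin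
    (f ⊕ v) (head₀ e)  ≡⟨ ⊕-other f h≢v ⟩
    f (head₀ e)        ≡⟨ outgoing e t≡v ⟩
    suc (f v)          ≡⟨ cong (suc ∘ f) t≡v ⟨
    suc (f (tail₀ e))  ≡⟨ ⊕-same f t≡v ⟨
    (f ⊕ v) (tail₀ e)  ∎)
    where open ≡-Reasoning
  ... | no t≢v | yes h≡v = ahead (begin
    (f ⊕ v) (head₀ e)        ≡⟨ ⊕-same f h≡v ⟩
    suc (f (head₀ e))        ≡⟨ cong (suc ∘ f) h≡v ⟩
    suc (f v)                ≡⟨ cong suc (incoming e h≡v) ⟨
    suc (f (tail₀ e))        ≡⟨ cong suc (⊕-other f t≢v) ⟨
    suc ((f ⊕ v) (tail₀ e))  ∎)
    where open ≡-Reasoning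
  ... | no t≢v | no h≢v = step-resp (sym (⊕-other f t≢v)) (sym (⊕-other f h≢v)) s

  admissible-zeros : Admissible zeros
  admissible-zeros = refl , λ e → level refl

  admissible-⊕ : ∀ {f v} → Admissible f → Ready f v → Admissible (f ⊕ v)
  admissible-⊕ {f} (f-sink , steps) ready@(v≢sink , _) =
    trans (⊕-other f (v≢sink ∘ sym)) f-sink , λ e → step-⊕ ready (steps e)

  admissible-run : ∀ {f vs D} → Admissible f → Run (orient f) vs D → Admissible (f ⊕* vs)
  admissible-run adm done = adm
  admissible-run {f} {v ∷ _} adm (step canFire r) =
    admissible-run (admissible-⊕ adm (canFire⇒ready adm canFire))
                   (subst (λ C → Run C _ _) (fire-orient f v) r)

  -- Along each edge the orientation fixes the difference of the counts at the two ends, and the sink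
  -- fixes the count 0; connectivity then fixes all counts.
  orient-injective : ∀ {f f′} → Admissible f → Admissible f′ → orient f ≡ orient f′ → f ≗ f′
  orient-injective {f} {f′} (f-sink , steps) (f′-sink , steps′) eq u = along (connected u sink)
    where
    sucIf-injective : ∀ b {x y} → sucIf b x ≡ sucIf b y → x ≡ y
    sucIf-injective true = suc-injective
    sucIf-injective false = id
    heads : ∀ e → f (head₀ e) ≡ sucIf (flips f′ e) (f (tail₀ e))
    heads e = trans (step-sucIf (steps e)) (cong (λ b → sucIf b (f (tail₀ e))) (orient-flips {f} {f′} eq e))
    across : ∀ {u w} → Adj u w → f w ≡ f′ w → f u ≡ f′ u
    across a agree with Adj⇒edge a
    ... | e , inj₁ (refl , refl) =
      sucIf-injective (flips f′ e) (trans (sym (heads e)) (trans agree (step-sucIf (steps′ e))))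
    ... | e , inj₂ (refl , refl) =
      trans (heads e) (trans (cong (sucIf (flips f′ e)) agree) (sym (step-sucIf (steps′ e))))
    along : ∀ {u} → Star Adj u sink → f u ≡ f′ u
    along ε = trans f-sink (sym f′-sink)
    along (a ◅ p) = across a (along p)

  pathLength : ∀ {u w} → Star Adj u w → ℕ
  pathLength ε = 0
  pathLength (_ ◅ p) = suc (pathLength p)

  distance : Fin n → ℕ
  distance u = pathLength (connected u sink)

  maxDistance : ℕ
  maxDistance = max 0 (map distance (allFin n))

  step-bounds : ∀ {f e} → Step f e → f (tail₀ e) ≤ f (head₀ e) × f (head₀ e) ≤ suc (f (tail₀ e))
  step-bounds (level h≡t) = ≤-reflexive (sym h≡t) , m≤n⇒m≤1+n (≤-reflexive h≡t)
  step-bounds (ahead h≡1+t) = ≤-trans (n≤1+n _) (≤-reflexive (sym h≡1+t)) , ≤-reflexive h≡1+t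

  adjacent-≤ : ∀ {f u w} → Admissible f → Adj u w → f u ≤ suc (f w)
  adjacent-≤ (_ , steps) a with Adj⇒edge a
  ... | e , inj₁ (refl , refl) = m≤n⇒m≤1+n (proj₁ (step-bounds (steps e)))
  ... | e , inj₂ (refl , refl) = proj₂ (step-bounds (steps e))

  path-≤ : ∀ {f u} → Admissible f → (p : Star Adj u sink) → f u ≤ pathLength p
  path-≤ (f-sink , _) ε = ≤-reflexive f-sink
  path-≤ adm (a ◅ p) = ≤-trans (adjacent-≤ adm a) (s≤s (path-≤ adm p))

  admissible-≤ : ∀ {f} → Admissible f → ∀ u → f u ≤ maxDistance
  admissible-≤ adm u = ≤-trans (path-≤ adm (connected u sink))
    (All.lookup (xs≤max 0 (map distance (allFin n))) (∈-map⁺ distance (∈-allFin u)))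

  -- The firing condition of the copy (v , j) in the layered game below.
  Enabled : Counts → Fin n → ℕ → Set
  Enabled f v j = v ≢ sink × f v ≤ j × (∀ e → tail₀ e ≡ v → j < f (head₀ e))
                                     × (∀ e → head₀ e ≡ v → j ≤ f (tail₀ e))

  ready⇒enabled : ∀ {f v} → Ready f v → Enabled f v (f v)
  ready⇒enabled (v≢sink , outgoing , incoming) =
    v≢sink , ≤-refl , (λ e t≡v → ≤-reflexive (sym (outgoing e t≡v)))
                    , (λ e h≡v → ≤-reflexive (sym (incoming e h≡v)))

  incidentEdge : ∀ {v} → v ≢ sink → ∃ λ e → tail₀ e ≡ v ⊎ head₀ e ≡ v
  incidentEdge {v} v≢sink with connected v sink
  ... | ε = ⊥-elim (v≢sink refl)
  ... | a ◅ _ with Adj⇒edge a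
  ...   | e , inj₁ (t≡v , _) = e , inj₁ t≡v
  ...   | e , inj₂ (_ , h≡v) = e , inj₂ h≡v

  enabled⇒ready : ∀ {f v j} → Admissible f → Enabled f v j → j ≡ f v × Ready f v
  enabled⇒ready {f} {v} {j} (_ , steps) (v≢sink , fv≤j , outgoing , incoming) =
    j≡fv , v≢sink , outgoing′ , incoming′
    where
    j≤fv : j ≤ f v
    j≤fv with incidentEdge v≢sink
    ... | e , inj₁ refl = s≤s⁻¹ (≤-trans (outgoing e refl) (proj₂ (step-bounds (steps e))))
    ... | e , inj₂ refl = ≤-trans (incoming e refl) (proj₁ (step-bounds (steps e)))
    j≡fv : j ≡ f v
    j≡fv = ≤-antisym j≤fv fv≤j
    outgoing′ : ∀ e → tail₀ e ≡ v → f (head₀ e) ≡ suc (f v)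
    outgoing′ e refl with steps e
    ... | level h≡t = ⊥-elim (<-irrefl (trans j≡fv (sym h≡t)) (outgoing e refl))
    ... | ahead h≡1+t = h≡1+t
    incoming′ : ∀ e → head₀ e ≡ v → f (tail₀ e) ≡ f v
    incoming′ e refl with steps e
    ... | level h≡t = sym h≡t
    ... | ahead h≡1+t =
      ⊥-elim (<-irrefl refl (≤-trans (≤-reflexive (sym (trans j≡fv h≡1+t))) (incoming e refl)))

-- Each edge of E with initial tail t and head h gives edges (t , j) → (h , j) and (h , j + 1) → (t , j),
-- so (h , j) fires before (t , j), which fires before (h , j + 1). An edge from the sink to each copy
-- lets it fire at most once; copies of the sink get an edge into the sink instead, so they never fire.
module Layered (E : EFG) (depth : ℕ)
               (admissible-≤depth : ∀ {f} → Admissibility.Admissible E f → ∀ u → f u ≤ depth) where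
  open EFG E
  open Counting E
  open Admissibility E

  Layer : Set
  Layer = Fin (suc depth)

  n′ : ℕ
  n′ = suc (n * suc depth)

  sink′ : Fin n′
  sink′ = zero

  copy : Fin n → Layer → Fin n′
  copy v j = suc (combine v j)

  copy-injective : ∀ {u i v j} → copy u i ≡ copy v j → u ≡ v × i ≡ j
  copy-injective {u} {i} {v} {j} eq = combine-injective u i v j (Fin.suc-injective eq)

  data VertexView : Fin n′ → Set where
    sinkVertex : VertexView sink′
    copyVertex : ∀ v j → VertexView (copy v j)

  vertexView : ∀ x → VertexView x
  vertexView zero = sinkVertex
  vertexView (suc k) = subst (VertexView ∘ suc) (combine-remQuot {n} (suc depth) k) (copyVertex _ _)

  Edge′ : Set
  Edge′ = (Fin n × Layer) ⊎ ((Fin m × Layer) ⊎ (Fin m × Fin depth))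

  pattern sinkEdge v j = inj₁ (v , j)
  pattern alongEdge e j = inj₂ (inj₁ (e , j))
  pattern acrossEdge e i = inj₂ (inj₂ (e , i))

  m′ : ℕ
  m′ = n * suc depth + (m * suc depth + m * depth)

  edgeCode : Fin m′ ↔ Edge′
  edgeCode = ↔-trans +↔⊎ (*↔× ⊎-↔ ↔-trans +↔⊎ (*↔× ⊎-↔ *↔×))

  decode : Fin m′ → Edge′
  decode = Inverse.to edgeCode

  code : Edge′ → Fin m′
  code = Inverse.from edgeCode

  decode-code : ∀ k → decode (code k) ≡ k
  decode-code = Inverse.strictlyInverseˡ edgeCode

  code-decode : ∀ e → code (decode e) ≡ e
  code-decode = Inverse.strictlyInverseʳ edgeCode

  data EdgeView : Fin m′ → Set where
    coded : ∀ k → EdgeView (code k)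

  edgeView : ∀ e → EdgeView e
  edgeView e = subst EdgeView (code-decode e) (coded (decode e))

  endsK : Edge′ → Fin n′ × Fin n′
  endsK (sinkEdge v j) = sink′ , copy v j
  endsK (alongEdge e j) = copy (tail₀ e) j , copy (head₀ e) j
  endsK (acrossEdge e i) = copy (head₀ e) (suc i) , copy (tail₀ e) (inject₁ i)

  initK : Edge′ → Bool
  initK (sinkEdge v j) = not ⌊ v ≟ sink ⌋
  initK (alongEdge _ _) = true
  initK (acrossEdge _ _) = true

  suc≢inject₁ : ∀ {k} (i : Fin k) → suc i ≢ inject₁ i
  suc≢inject₁ i eq = 1+n≢n (trans (cong toℕ eq) (toℕ-inject₁ i))

  looplessK : ∀ k → proj₁ (endsK k) ≢ proj₂ (endsK k)
  looplessK (sinkEdge _ _) ()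
  looplessK (alongEdge e _) eq = tail₀≢head₀ e (proj₁ (copy-injective eq))
  looplessK (acrossEdge _ i) eq = suc≢inject₁ i (proj₂ (copy-injective eq))

  -- Along-edges join copies in the same layer, across-edges copies in adjacent layers.
  noMultiK : ∀ k k′ → SameEnds (endsK k) (endsK k′) → k ≡ k′
  noMultiK (sinkEdge _ _) (sinkEdge _ _) (inj₁ (_ , q)) with copy-injective q
  ... | refl , refl = refl
  noMultiK (sinkEdge _ _) (sinkEdge _ _) (inj₂ (() , _))
  noMultiK (sinkEdge _ _) (alongEdge _ _) (inj₁ (() , _))
  noMultiK (sinkEdge _ _) (alongEdge _ _) (inj₂ (() , _))
  noMultiK (sinkEdge _ _) (acrossEdge _ _) (inj₁ (() , _))
  noMultiK (sinkEdge _ _) (acrossEdge _ _) (inj₂ (() , _))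
  noMultiK (alongEdge _ _) (sinkEdge _ _) (inj₁ (() , _))
  noMultiK (alongEdge _ _) (sinkEdge _ _) (inj₂ (_ , ()))
  noMultiK (acrossEdge _ _) (sinkEdge _ _) (inj₁ (() , _))
  noMultiK (acrossEdge _ _) (sinkEdge _ _) (inj₂ (_ , ()))
  noMultiK (alongEdge _ _) (alongEdge _ _) (inj₁ (p , q)) with copy-injective p | copy-injective q
  ... | t≡t′ , refl | h≡h′ , _ = cong (λ e → alongEdge e _) (edge-injective (inj₁ (t≡t′ , h≡h′)))
  noMultiK (alongEdge _ _) (alongEdge _ _) (inj₂ (p , q)) with copy-injective p | copy-injective q
  ... | t≡h′ , refl | h≡t′ , _ = cong (λ e → alongEdge e _) (edge-injective (inj₂ (t≡h′ , h≡t′)))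
  noMultiK (alongEdge _ _) (acrossEdge _ i) (inj₁ (p , q)) with copy-injective p | copy-injective q
  ... | _ , refl | _ , i+1≡i = ⊥-elim (suc≢inject₁ i i+1≡i)
  noMultiK (alongEdge _ _) (acrossEdge _ i) (inj₂ (p , q)) with copy-injective p | copy-injective q
  ... | _ , refl | _ , i≡i+1 = ⊥-elim (suc≢inject₁ i (sym i≡i+1))
  noMultiK (acrossEdge _ i) (alongEdge _ _) (inj₁ (p , q)) with copy-injective p | copy-injective q
  ... | _ , refl | _ , i≡i+1 = ⊥-elim (suc≢inject₁ i (sym i≡i+1))
  noMultiK (acrossEdge _ i) (alongEdge _ _) (inj₂ (p , q)) with copy-injective p | copy-injective q
  ... | _ , refl | _ , i≡i+1 = ⊥-elim (suc≢inject₁ i (sym i≡i+1))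
  noMultiK (acrossEdge _ _) (acrossEdge _ _) (inj₁ (p , q)) with copy-injective p | copy-injective q
  ... | h≡h′ , refl | t≡t′ , _ = cong (λ e → acrossEdge e _) (edge-injective (inj₁ (t≡t′ , h≡h′)))
  noMultiK (acrossEdge _ i) (acrossEdge _ i′) (inj₂ (p , q)) with copy-injective p | copy-injective q
  ... | _ , i+1≡i′ | _ , i≡i′+1 = ⊥-elim (crossed i i′ i+1≡i′ i≡i′+1)
    where
    crossed : ∀ {k} (i i′ : Fin k) → suc i ≡ inject₁ i′ → inject₁ i ≡ suc i′ → ⊥
    crossed i i′ p q = n≢2+n (begin
      toℕ i             ≡⟨ toℕ-inject₁ i ⟨
      toℕ (inject₁ i)   ≡⟨ cong toℕ q ⟩
      suc (toℕ i′)      ≡⟨ cong suc (toℕ-inject₁ i′) ⟨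
      suc (toℕ (inject₁ i′)) ≡⟨ cong (suc ∘ toℕ) p ⟨
      suc (suc (toℕ i)) ∎)
      where
      open ≡-Reasoning
      n≢2+n : ∀ {x} → x ≢ suc (suc x)
      n≢2+n ()

  ends′ : Fin m′ → Fin n′ × Fin n′
  ends′ = endsK ∘ decode

  Adj′ : Fin n′ → Fin n′ → Set
  Adj′ x y = ∃ λ e → SameEnds (ends′ e) (x , y)

  copy-adjacent-sink : ∀ v j → Adj′ (copy v j) sink′
  copy-adjacent-sink v j = code (sinkEdge v j) ,
    subst (λ p → SameEnds p (copy v j , sink′)) (sym (cong endsK (decode-code (sinkEdge v j))))
          (inj₂ (refl , refl))

  adjacent-sink : ∀ x → x ≢ sink′ → Adj′ x sink′
  adjacent-sink x x≢sink with vertexView x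
  ... | sinkVertex = ⊥-elim (x≢sink refl)
  ... | copyVertex v j = copy-adjacent-sink v j

  path-sink : ∀ x → Star Adj′ x sink′
  path-sink x with vertexView x
  ... | sinkVertex = ε
  ... | copyVertex v j = copy-adjacent-sink v j ◅ ε

  graph′ : Graph
  graph′ = record
    { n = n′
    ; m = m′
    ; ends = ends′
    ; loopless = looplessK ∘ decode
    ; noMulti = λ e e′ s → begin
        e                 ≡⟨ code-decode e ⟨
        code (decode e)   ≡⟨ cong code (noMultiK (decode e) (decode e′) s) ⟩
        code (decode e′)  ≡⟨ code-decode e′ ⟩
        e′                ∎
    ; connected = λ x y → path-sink x ◅◅ reverse (λ (e , s) → e , sameEnds-swap s) (path-sink y)
    }
    where open ≡-Reasoning

  E′ : EFG
  E′ = record { graph = graph′ ; sink = sink′ ; initial = tabulate (initK ∘ decode) }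

  E′-simple : IsSimple E′
  E′-simple = Firing.sinkAdjacent⇒simple E′ adjacent-sink

  module C′ = Counting E′
  open EFG E′ using () renaming (CanFire to CanFire′; tailOf to tailOf′)

  tail′ head′ : Edge′ → Fin n′
  tail′ k = if initK k then proj₁ (endsK k) else proj₂ (endsK k)
  head′ k = if initK k then proj₂ (endsK k) else proj₁ (endsK k)

  tail₀′-code : ∀ k → C′.tail₀ (code k) ≡ tail′ k
  tail₀′-code k rewrite lookup∘tabulate (initK ∘ decode) (code k) | decode-code k = refl

  head₀′-code : ∀ k → C′.head₀ (code k) ≡ head′ k
  head₀′-code k rewrite lookup∘tabulate (initK ∘ decode) (code k) | decode-code k = refl

  sinkEdge-at-sink : ∀ {v} j → v ≡ sink → tail′ (sinkEdge v j) ≡ copy v j × head′ (sinkEdge v j) ≡ sink′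
  sinkEdge-at-sink {v} j v≡sink rewrite ⌊⌋-yes (v ≟ sink) v≡sink = refl , refl

  sinkEdge-elsewhere : ∀ {v} j → v ≢ sink → tail′ (sinkEdge v j) ≡ sink′ × head′ (sinkEdge v j) ≡ copy v j
  sinkEdge-elsewhere {v} j v≢sink rewrite ⌊⌋-no (v ≟ sink) v≢sink = refl , refl

  fired : Counts → Fin n → Layer → Bool
  fired f v j = toℕ j <ᵇ f v

  firedAt : Counts → Fin n′ → Bool
  firedAt f zero = false
  firedAt f (suc k) = uncurry (fired f) (remQuot (suc depth) k)

  firedAt-copy : ∀ f v j → firedAt f (copy v j) ≡ fired f v j
  firedAt-copy f v j = cong (uncurry (fired f)) (remQuot-combine v j)

  layered : Counts → C′.Counts
  layered f x = if firedAt f x then 1 else 0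

  odd-layered : ∀ f x → odd (layered f x) ≡ firedAt f x
  odd-layered f x with firedAt f x
  ... | true = refl
  ... | false = refl

  layered-cong : ∀ {f f′} → f ≗ f′ → layered f ≗ layered f′
  layered-cong f≗f′ zero = refl
  layered-cong f≗f′ (suc k) = cong (λ a → if toℕ (proj₂ (remQuot {n} (suc depth) k)) <ᵇ a then 1 else 0)
                                   (f≗f′ (proj₁ (remQuot {n} (suc depth) k)))

  layered-zeros : layered zeros ≗ C′.zeros
  layered-zeros zero = refl
  layered-zeros (suc _) = refl

  orient′ : Counts → EFG.Orientation E′
  orient′ f = C′.orient (layered f)

  orient′-cong : ∀ {f f′} → f ≗ f′ → orient′ f ≡ orient′ f′
  orient′-cong f≗f′ = C′.orient-cong (layered-cong f≗f′)

  orient′-zeros : orient′ zeros ≡ EFG.initial E′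
  orient′-zeros = trans (C′.orient-cong layered-zeros) C′.orient-zeros

  fired-closed : ∀ {f} → Admissible f → ∀ k → firedAt f (tail′ k) ≡ true → firedAt f (head′ k) ≡ true
  fired-closed {f} (f-sink , _) (sinkEdge v j) t-fired with v ≟ sink
  ... | yes refl rewrite firedAt-copy f v j | f-sink = t-fired
  fired-closed {f} (f-sink , _) (sinkEdge v j) () | no _
  fired-closed {f} (_ , steps) (alongEdge e j) t-fired
    rewrite firedAt-copy f (tail₀ e) j | firedAt-copy f (head₀ e) j =
    <ᵇ-true (≤-trans (<ᵇ-true⁻¹ t-fired) (proj₁ (step-bounds (steps e))))
  fired-closed {f} (_ , steps) (acrossEdge e i) t-fired
    rewrite firedAt-copy f (head₀ e) (suc i) | firedAt-copy f (tail₀ e) (inject₁ i) | toℕ-inject₁ i =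
    <ᵇ-true (s≤s⁻¹ (≤-trans (<ᵇ-true⁻¹ t-fired) (proj₂ (step-bounds (steps e)))))

  flips-layered : ∀ f k → C′.flips (layered f) (code k) ≡ firedAt f (tail′ k) xor firedAt f (head′ k)
  flips-layered f k =
    trans (cong₂ (λ x y → odd (layered f x) xor odd (layered f y)) (tail₀′-code k) (head₀′-code k))
          (cong₂ _xor_ (odd-layered f (tail′ k)) (odd-layered f (head′ k)))

  tailOf-layered : ∀ {f} → Admissible f → ∀ k →
                   tailOf′ (orient′ f) (code k)
                   ≡ (if firedAt f (head′ k) ∧ not (firedAt f (tail′ k)) then head′ k else tail′ k)
  tailOf-layered {f} adm k = begin
    tailOf′ (orient′ f) (code k)
      ≡⟨ C′.tailOf-orient (layered f) (code k) ⟩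
    (if C′.flips (layered f) (code k) then C′.head₀ (code k) else C′.tail₀ (code k))
      ≡⟨ cong₂ (if_then_else_ (C′.flips (layered f) (code k))) (head₀′-code k) (tail₀′-code k) ⟩
    (if C′.flips (layered f) (code k) then head′ k else tail′ k)
      ≡⟨ cong (λ b → if b then head′ k else tail′ k)
              (trans (flips-layered f k) (xor-closed (fired-closed adm k))) ⟩
    (if firedAt f (head′ k) ∧ not (firedAt f (tail′ k)) then head′ k else tail′ k) ∎
    where open ≡-Reasoning

  tailOf-unfired-head : ∀ {f} → Admissible f → ∀ k → firedAt f (head′ k) ≡ false →
                        tailOf′ (orient′ f) (code k) ≡ tail′ k
  tailOf-unfired-head {f} adm k h-unfired =
    trans (tailOf-layered adm k)
          (cong (λ b → if b ∧ not (firedAt f (tail′ k)) then head′ k else tail′ k) h-unfired)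

  tailOf-fired-head : ∀ {f} → Admissible f → ∀ k → firedAt f (head′ k) ≡ true → firedAt f (tail′ k) ≡ false →
                      tailOf′ (orient′ f) (code k) ≡ head′ k
  tailOf-fired-head {f} adm k h-fired t-unfired =
    trans (tailOf-layered adm k) (cong₂ (λ a c → if a ∧ not c then head′ k else tail′ k) h-fired t-unfired)

  copy-unfired : ∀ f v {j} → f v ≤ toℕ j → firedAt f (copy v j) ≡ false
  copy-unfired f v {j} fv≤j = trans (firedAt-copy f v j) (<ᵇ-false fv≤j)

  enabled⇒heads-fired : ∀ {f v j} → Enabled f v (toℕ j) → ∀ k → tail′ k ≡ copy v j → firedAt f (head′ k) ≡ true
  enabled⇒heads-fired (v≢sink , _) (sinkEdge u i) t≡x with u ≟ sink
  ... | yes refl = ⊥-elim (v≢sink (sym (proj₁ (copy-injective t≡x))))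
  enabled⇒heads-fired _ (sinkEdge u i) () | no _
  enabled⇒heads-fired {f} {j = j} (_ , _ , outgoing , _) (alongEdge e _) t≡x with copy-injective t≡x
  ... | t≡v , refl = trans (firedAt-copy f (head₀ e) j) (<ᵇ-true (outgoing e t≡v))
  enabled⇒heads-fired {f} (_ , _ , _ , incoming) (acrossEdge e i) t≡x with copy-injective t≡x
  ... | h≡v , refl = trans (firedAt-copy f (tail₀ e) (inject₁ i))
                           (<ᵇ-true (subst (_< f (tail₀ e)) (sym (toℕ-inject₁ i)) (incoming e h≡v)))

  enabled⇒canFire′ : ∀ {f v j} → Admissible f → Enabled f v (toℕ j) → CanFire′ (orient′ f) (copy v j)
  enabled⇒canFire′ {f} {v} {j} adm enabled@(_ , fv≤j , _) = (λ ()) , noOut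
    where
    noOut : ∀ e → tailOf′ (orient′ f) e ≢ copy v j
    noOut e t≡x with edgeView e
    ... | coded k with if-split (firedAt f (head′ k) ∧ not (firedAt f (tail′ k)))
                                (trans (sym (tailOf-layered adm k)) t≡x)
    ...   | inj₁ (b≡true , h≡x) = false≢true (begin
      false                 ≡⟨ copy-unfired f v fv≤j ⟨
      firedAt f (copy v j)  ≡⟨ cong (firedAt f) h≡x ⟨
      firedAt f (head′ k)   ≡⟨ proj₁ (∧-not-true _ _ b≡true) ⟩
      true                  ∎)
      where open ≡-Reasoning
    ...   | inj₂ (b≡false , t≡x′) = false≢true (trans (sym b≡false)
      (cong₂ (λ a c → a ∧ not c) (enabled⇒heads-fired enabled k t≡x′)
                                 (trans (cong (firedAt f) t≡x′) (copy-unfired f v fv≤j))))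

  canFire′⇒enabled : ∀ {f v j} → Admissible f → CanFire′ (orient′ f) (copy v j) → Enabled f v (toℕ j)
  canFire′⇒enabled {f} {v} {j} adm (_ , noOut) = v≢sink , fv≤j , outgoing , incoming
    where
    head-fired : ∀ k → tail′ k ≡ copy v j → firedAt f (head′ k) ≡ true
    head-fired k t≡x with firedAt f (head′ k) in eq
    ... | true = refl
    ... | false = ⊥-elim (noOut (code k) (trans (tailOf-unfired-head adm k eq) t≡x))
    unfired : ∀ k → head′ k ≡ copy v j → firedAt f (tail′ k) ≡ false → firedAt f (copy v j) ≡ false
    unfired k h≡x t-unfired with firedAt f (copy v j) in eq
    ... | false = refl
    ... | true =
      ⊥-elim (noOut (code k) (trans (tailOf-fired-head adm k (trans (cong (firedAt f) h≡x) eq) t-unfired) h≡x))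
    v≢sink : v ≢ sink
    v≢sink v≡sink with sinkEdge-at-sink j v≡sink
    ... | t≡x , h≡sink′ = false≢true (trans (sym (cong (firedAt f) h≡sink′)) (head-fired (sinkEdge v j) t≡x))
    fv≤j : f v ≤ toℕ j
    fv≤j with sinkEdge-elsewhere j v≢sink
    ... | t≡sink′ , h≡x =
      <ᵇ-false⁻¹ (trans (sym (firedAt-copy f v j)) (unfired (sinkEdge v j) h≡x (cong (firedAt f) t≡sink′)))
    outgoing : ∀ e → tail₀ e ≡ v → toℕ j < f (head₀ e)
    outgoing e refl = <ᵇ-true⁻¹ (trans (sym (firedAt-copy f (head₀ e) j)) (head-fired (alongEdge e j) refl))
    incoming : ∀ e → head₀ e ≡ v → toℕ j ≤ f (tail₀ e)
    incoming e refl = atLayer j refl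
      where
      atLayer : ∀ j′ → j′ ≡ j → toℕ j′ ≤ f (tail₀ e)
      atLayer zero _ = z≤n
      atLayer (suc i) j′≡j = subst (_< f (tail₀ e)) (toℕ-inject₁ i)
        (<ᵇ-true⁻¹ (trans (sym (firedAt-copy f (tail₀ e) (inject₁ i)))
                          (head-fired (acrossEdge e i) (cong (copy v) j′≡j))))

  fired-⊕ : ∀ {f u i v j} → toℕ j ≡ f v → copy u i ≢ copy v j → fired (f ⊕ v) u i ≡ fired f u i
  fired-⊕ {f} {u} {i} {v} {j} j≡fv x≢x′ with u ≟ v
  ... | yes refl = <ᵇ-suc λ i≡fu → x≢x′ (cong (copy u) (toℕ-injective (trans i≡fu (sym j≡fv))))
  ... | no _ = refl

  layered-⊕ : ∀ {f v j} → toℕ j ≡ f v → (layered f C′.⊕ copy v j) ≗ layered (f ⊕ v)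
  layered-⊕ {f} {v} {j} j≡fv y with vertexView y
  ... | sinkVertex = refl
  ... | copyVertex u i with copy u i ≟ copy v j
  ...   | no x≢x′ = cong (λ b → if b then 1 else 0)
          (trans (firedAt-copy f u i) (trans (sym (fired-⊕ j≡fv x≢x′)) (sym (firedAt-copy (f ⊕ v) u i))))
  ...   | yes x≡x′ with copy-injective x≡x′
  ...     | refl , refl = begin
    suc (layered f (copy v j))  ≡⟨ cong (λ b → suc (if b then 1 else 0)) (copy-unfired f v (≤-reflexive (sym j≡fv))) ⟩
    1                           ≡⟨ cong (λ b → if b then 1 else 0) copy-fired ⟨
    layered (f ⊕ v) (copy v j)  ∎
    where
    open ≡-Reasoning
    copy-fired : firedAt (f ⊕ v) (copy v j) ≡ true
    copy-fired = trans (firedAt-copy (f ⊕ v) v j)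
                       (<ᵇ-true (subst (toℕ j <_) (sym (⊕-same f refl)) (s≤s (≤-reflexive j≡fv))))

  fire′-orient′ : ∀ {f v j} → toℕ j ≡ f v → EFG.fire E′ (copy v j) (orient′ f) ≡ orient′ (f ⊕ v)
  fire′-orient′ {f} {v} {j} j≡fv =
    trans (C′.fire-orient (layered f) (copy v j)) (C′.orient-cong (layered-⊕ j≡fv))

  flips-sinkEdge : ∀ f {u} i → u ≢ sink → C′.flips (layered f) (code (sinkEdge u i)) ≡ fired f u i
  flips-sinkEdge f {u} i u≢sink with sinkEdge-elsewhere i u≢sink
  ... | t≡sink′ , h≡x = trans (flips-layered f (sinkEdge u i))
    (trans (cong₂ (λ x y → firedAt f x xor firedAt f y) t≡sink′ h≡x) (firedAt-copy f u i))

  layered-injective : ∀ {f f′} → Admissible f → Admissible f′ →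
                      orient′ f ≡ orient′ f′ → f ≗ f′
  layered-injective {f} {f′} adm adm′ eq u with u ≟ sink
  ... | yes refl = trans (proj₁ adm) (sym (proj₁ adm′))
  ... | no u≢sink =
    ≤-antisym (<ᵇ-agree⇒≤ (admissible-≤depth adm′ u) agree) (<ᵇ-agree⇒≤ (admissible-≤depth adm u) (sym ∘ agree))
    where
    agree : ∀ i → fired f u i ≡ fired f′ u i
    agree i = begin
      fired f u i                                ≡⟨ flips-sinkEdge f i u≢sink ⟨
      C′.flips (layered f) (code (sinkEdge u i))   ≡⟨ C′.orient-flips {layered f} {layered f′} eq (code (sinkEdge u i)) ⟩
      C′.flips (layered f′) (code (sinkEdge u i))  ≡⟨ flips-sinkEdge f′ i u≢sink ⟩
      fired f′ u i                               ∎
      where open ≡-Reasoning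

module Simulation (E : EFG) (depth : ℕ)
                  (admissible-≤depth : ∀ {f} → Admissibility.Admissible E f → ∀ u → f u ≤ depth) where
  open EFG E
  open Counting E
  open Admissibility E
  open Layered E depth admissible-≤depth
  module E′ = EFG E′

  -- Firing v in E is simulated by firing the copy of v in layer f v.
  simulate : ∀ {f vs D} → Admissible f → Run (orient f) vs D → orient′ f E′.≽ orient′ (f ⊕* vs)
  simulate adm done = [] , E′.done
  simulate {f} {v ∷ vs} {D} adm (step canFire r) = copy v j ∷ proj₁ rest , E′.step canFire′ rest-from-copy
    where
    ready : Ready f v
    ready = canFire⇒ready adm canFire
    j : Layer
    j = fromℕ< (s≤s (admissible-≤depth adm v))
    j≡fv : toℕ j ≡ f v
    j≡fv = toℕ-fromℕ< (s≤s (admissible-≤depth adm v))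
    canFire′ : E′.CanFire (orient′ f) (copy v j)
    canFire′ = enabled⇒canFire′ adm (subst (Enabled f v) (sym j≡fv) (ready⇒enabled ready))
    rest : orient′ (f ⊕ v) E′.≽ orient′ ((f ⊕ v) ⊕* vs)
    rest = simulate (admissible-⊕ adm ready) (subst (λ C → Run C vs D) (fire-orient f v) r)
    rest-from-copy : E′.Run (E′.fire (copy v j) (orient′ f)) (proj₁ rest) (orient′ ((f ⊕ v) ⊕* vs))
    rest-from-copy =
      subst (λ C → E′.Run C (proj₁ rest) (orient′ ((f ⊕ v) ⊕* vs))) (sym (fire′-orient′ j≡fv)) (proj₂ rest)

  unsimulate : ∀ {f ws D} → Admissible f → E′.Run (orient′ f) ws D →
               ∃ λ vs → Run (orient f) vs (orient (f ⊕* vs)) × D ≡ orient′ (f ⊕* vs)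
  unsimulate adm E′.done = [] , done , refl
  unsimulate {f} {x ∷ ws} {D} adm (E′.step canFire′ r′) with vertexView x
  ... | sinkVertex = ⊥-elim (proj₁ canFire′ refl)
  ... | copyVertex v j with enabled⇒ready adm (canFire′⇒enabled adm canFire′)
  ...   | j≡fv , ready
    with unsimulate (admissible-⊕ adm ready) (subst (λ C → E′.Run C ws D) (fire′-orient′ j≡fv) r′)
  ...     | vs , r , D≡ = v ∷ vs , step (ready⇒canFire adm ready) r-from-v , D≡
    where
    r-from-v : Run (fire v (orient f)) vs (orient ((f ⊕ v) ⊕* vs))
    r-from-v = subst (λ C → Run C vs (orient ((f ⊕ v) ⊕* vs))) (sym (fire-orient f v)) r

  countsOf : Config → Counts
  countsOf (_ , vs , _) = zeros ⊕* vs

  fromZeros : ∀ {vs C} → Run initial vs C → Run (orient zeros) vs C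
  fromZeros {vs} {C} = subst (λ C₀ → Run C₀ vs C) (sym orient-zeros)

  countsOf-admissible : ∀ x → Admissible (countsOf x)
  countsOf-admissible (_ , _ , r) = admissible-run admissible-zeros (fromZeros r)

  orient-countsOf : ∀ x → proj₁ x ≡ orient (countsOf x)
  orient-countsOf (_ , _ , r) = run-orient zeros (fromZeros r)

  unsimulateConfig : (y : E′.Config) → ∃ λ vs → Run (orient zeros) vs (orient (zeros ⊕* vs))
                                              × proj₁ y ≡ orient′ (zeros ⊕* vs)
  unsimulateConfig (C′ , ws , r′) =
    unsimulate admissible-zeros (subst (λ C → E′.Run C ws C′) (sym orient′-zeros) r′)

  configIso : ConfigIso E E′
  configIso = record
    { to = to
    ; from = from
    ; from∘to = from∘to
    ; to∘from = to∘from
    ; to-mono = to-mono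
    ; to-reflect = to-reflect
    }
    where
    to : Config → E′.Config
    to x@(_ , _ , r) =
      orient′ (countsOf x) ,
      subst (E′._≽ orient′ (countsOf x)) orient′-zeros (simulate admissible-zeros (fromZeros r))

    from : E′.Config → Config
    from y = orient (zeros ⊕* vs) , vs , subst (λ C → Run C vs (orient (zeros ⊕* vs))) orient-zeros r
      where
      vs : List (Fin n)
      vs = proj₁ (unsimulateConfig y)
      r : Run (orient zeros) vs (orient (zeros ⊕* vs))
      r = proj₁ (proj₂ (unsimulateConfig y))

    from∘to : ∀ x → proj₁ (from (to x)) ≡ proj₁ x
    from∘to x with unsimulateConfig (to x)
    ... | vs , r , eq = trans (orient-cong (sym ∘ same)) (sym (orient-countsOf x))
      where
      same : countsOf x ≗ zeros ⊕* vs
      same = layered-injective (countsOf-admissible x) (admissible-run admissible-zeros r) eq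

    to∘from : ∀ y → proj₁ (to (from y)) ≡ proj₁ y
    to∘from y = sym (proj₂ (proj₂ (unsimulateConfig y)))

    to-mono : ∀ x y → x ≥ᶜ y → to x E′.≥ᶜ to y
    to-mono x y (ws , r) =
      subst (orient′ (countsOf x) E′.≽_) (orient′-cong (sym ∘ same)) (simulate (countsOf-admissible x) r₀)
      where
      r₀ : Run (orient (countsOf x)) ws (proj₁ y)
      r₀ = subst (λ C → Run C ws (proj₁ y)) (orient-countsOf x) r
      same : countsOf y ≗ countsOf x ⊕* ws
      same = orient-injective (countsOf-admissible y) (admissible-run (countsOf-admissible x) r₀)
                              (trans (sym (orient-countsOf y)) (run-orient (countsOf x) r₀))

    to-reflect : ∀ x y → to x E′.≥ᶜ to y → x ≥ᶜ y
    to-reflect x y (ws , r′) with unsimulate (countsOf-admissible x) r′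
    ... | vs , r , eq = vs , subst₂ (λ C D → Run C vs D) (sym (orient-countsOf x))
                                    (trans (orient-cong (sym ∘ same)) (sym (orient-countsOf y))) r
      where
      same : countsOf y ≗ countsOf x ⊕* vs
      same = layered-injective (countsOf-admissible y) (admissible-run (countsOf-admissible x) r) eq

mainTheorem3 : (E : EFG) → ∃ λ (E′ : EFG) → IsSimple E′ × ConfigIso E E′
mainTheorem3 E = Layered.E′ E maxDistance admissible-≤ ,
                 Layered.E′-simple E maxDistance admissible-≤ ,
                 Simulation.configIso E maxDistance admissible-≤
  where open Admissibility E
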